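{- For all DMTS $\mathcal D_1,\mathcal D_2$ and all $\nu$-calculus expressions in normal form $\mathcal N_1,\mathcal N_2$ (over the label poset $(\Sigma,\sqsubseteq)$): $\mathcal D_1\le_m\mathcal D_2$ iff $\mathrm{dh}(\mathcal D_1)\le_m\mathrm{dh}(\mathcal D_2)$, and $\mathcal N_1\le_m\mathcal N_2$ iff $\mathrm{hd}(\mathcal N_1)\le_m\mathrm{hd}(\mathcal N_2)$.
   Context: $\Sigma$ is a set of labels with a partial order $\sqsubseteq$. A DMTS is $\mathcal D=(S,S^0,\dashrightarrow,\to)$ with $S$ finite, $S^0\subseteq S$, may-transitions $\dashrightarrow\subseteq S\times\Sigma\times S$ and disjunctive must-transitions $\to\subseteq S\times 2^{\Sigma\times S}$ (written $s\to N$), such that for every $s\to N$ and $(a,t)\in N$ there is $s\overset{b}{\dashrightarrow}t$ with $a\sqsubseteq b$. For DMTS, a relation $R\subseteq S_1\times S_2$ is a modal refinement if for all $(s_1,s_2)\in R$: for every $s_1\overset{a_1}{\dashrightarrow}_1t_1$ there is $s_2\overset{a_2}{\dashrightarrow}_2t_2$ with $a_1\sqsubseteq a_2$, $(t_1,t_2)\in R$; and for every $s_2\to_2N_2$ there is $s_1\to_1N_1$ such that every $(a_1,t_1)\in N_1$ has some $(a_2,t_2)\in N_2$ with $a_1\sqsubseteq a_2$, $(t_1,t_2)\in R$. A $\nu$-calculus expression in normal form is $\mathcal N=(X,X^0,\Delta)$ with $X$ a finite set of variables, $X^0\subseteq X$, and for each $x\in X$, $\Delta(x)=\bigwedge_{N\in\Diamond(x)}\big(\bigvee_{(a,y)\in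 N}\langle a\rangle y\big)\wedge\bigwedge_{a\in\Sigma}[a]\big(\bigvee_{y\in\Box^a(x)}y\big)$, where $\Diamond(x)$ is a finite set of finite subsets of $\Sigma\times X$ and $\Box^a(x)\subseteq X$. For such expressions, $R\subseteq X_1\times X_2$ is a modal refinement if for all $(x_1,x_2)\in R$: for every $a_1\in\Sigma$ and $y_1\in\Box_1^{a_1}(x_1)$ there are $a_2\in\Sigma$, $y_2\in\Box_2^{a_2}(x_2)$ with $a_1\sqsubseteq a_2$, $(y_1,y_2)\in R$; and for every $N_2\in\Diamond_2(x_2)$ there is $N_1\in\Diamond_1(x_1)$ such that every $(a_1,y_1)\in N_1$ has some $(a_2,y_2)\in N_2$ with $a_1\sqsubseteq a_2$, $(y_1,y_2)\in R$. In both formalisms, $\mathcal S_1\le_m\mathcal S_2$ means there is a modal refinement relating every initial state/variable of $\mathcal S_1$ to some initial state/variable of $\mathcal S_2$. Translations: for a DMTS $\mathcal D$, $\mathrm{dh}(\mathcal D)=(S,S^0,\Delta)$ with $\Diamond(s)=\{N\mid s\to N\}$ and $\Box^a(s)=\{t\mid s\overset{a}{\dashrightarrow}t\}$; for a normal-form expression $\mathcal N$, $\mathrm{hd}(\mathcal N)=(X,X^0,\dashrightarrow,\to)$ with $\dashrightarrow=\{(x,a,y)\mid y\in\Box^a(x)\}$ and $\to=\{(x,N)\mid N\in\Diamond(x)\}$. -}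

module Defs where

open import Level using (0ℓ)
open import Data.Nat using (ℕ)
open import Data.Fin using (Fin)
open import Data.List using (List)
open import Data.List.Membership.Propositional using (_∈_)
open import Data.Product using (Σ; ∃; _×_; _,_)
open import Relation.Binary.Bundles using (Poset)

module _ (P : Poset 0ℓ 0ℓ 0ℓ) where
  open Poset P renaming (Carrier to Lab; _≤_ to _⊑_)

  record PreDMTS : Set₁ where
    field
      size  : ℕ
      init  : Fin size → Set
      may   : Fin size → Lab → Fin size → Set
      must  : Fin size → List (Lab × Fin size) → Set

  Consistent : PreDMTS → Set
  Consistent D = ∀ s N a t → must s N → (a , t) ∈ N →
                 ∃ λ b → a ⊑ b × may s b t
    where open PreDMTS D

  record DMTS : Set₁ where
    field
      pre        : PreDMTS
      consistent : Consistent pre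
  open DMTS public

  IsRefinementD : (D₁ D₂ : PreDMTS) →
    (Fin (PreDMTS.size D₁) → Fin (PreDMTS.size D₂) → Set) → Set
  IsRefinementD D₁ D₂ R = ∀ s₁ s₂ → R s₁ s₂ →
      (∀ a₁ t₁ → M.may s₁ a₁ t₁ →
         ∃ λ a₂ → ∃ λ t₂ → N.may s₂ a₂ t₂ × a₁ ⊑ a₂ × R t₁ t₂)
    × (∀ N₂ → N.must s₂ N₂ →
         ∃ λ N₁ → M.must s₁ N₁ ×
           (∀ a₁ t₁ → (a₁ , t₁) ∈ N₁ →
              ∃ λ a₂ → ∃ λ t₂ → (a₂ , t₂) ∈ N₂ × a₁ ⊑ a₂ × R t₁ t₂))
    where module M = PreDMTS D₁
          module N = PreDMTS D₂

  _≤mD_ : PreDMTS → PreDMTS → Set₁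
  D₁ ≤mD D₂ = ∃ λ (R : Fin (PreDMTS.size D₁) → Fin (PreDMTS.size D₂) → Set) →
      IsRefinementD D₁ D₂ R ×
      (∀ s₁ → PreDMTS.init D₁ s₁ → ∃ λ s₂ → PreDMTS.init D₂ s₂ × R s₁ s₂)

  -- ν-calculus expressions in normal form: variables X = Fin size,
  -- Δ(x) is determined by ◇(x) (a set of finite subsets of Lab × X,
  -- given by its membership predicate) and □ᵃ(x) ⊆ X.
  record NF : Set₁ where
    field
      size  : ℕ
      init  : Fin size → Set
      dia   : Fin size → List (Lab × Fin size) → Set
      box   : Fin size → Lab → Fin size → Set

  IsRefinementN : (N₁ N₂ : NF) →
    (Fin (NF.size N₁) → Fin (NF.size N₂) → Set) → Set
  IsRefinementN E₁ E₂ R = ∀ x₁ x₂ → R x₁ x₂ →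
      (∀ a₁ y₁ → M.box x₁ a₁ y₁ →
         ∃ λ a₂ → ∃ λ y₂ → N.box x₂ a₂ y₂ × a₁ ⊑ a₂ × R y₁ y₂)
    × (∀ N₂ → N.dia x₂ N₂ →
         ∃ λ N₁ → M.dia x₁ N₁ ×
           (∀ a₁ y₁ → (a₁ , y₁) ∈ N₁ →
              ∃ λ a₂ → ∃ λ y₂ → (a₂ , y₂) ∈ N₂ × a₁ ⊑ a₂ × R y₁ y₂))
    where module M = NF E₁
          module N = NF E₂

  _≤mN_ : NF → NF → Set₁
  E₁ ≤mN E₂ = ∃ λ (R : Fin (NF.size E₁) → Fin (NF.size E₂) → Set) →
      IsRefinementN E₁ E₂ R ×
      (∀ x₁ → NF.init E₁ x₁ → ∃ λ x₂ → NF.init E₂ x₂ × R x₁ x₂)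

  dh : DMTS → NF
  dh D = record
    { size = PreDMTS.size (pre D)
    ; init = PreDMTS.init (pre D)
    ; dia  = λ s N → PreDMTS.must (pre D) s N
    ; box  = λ s a t → PreDMTS.may (pre D) s a t
    }

  hd : NF → PreDMTS
  hd E = record
    { size = NF.size E
    ; init = NF.init E
    ; may  = λ x a y → NF.box E x a y
    ; must = λ x N → NF.dia E x N
    }

module Submission where

open import Defs
open import Level using (0ℓ)
open import Data.Product using (_×_; _,_)
open import Function.Bundles using (_⇔_)
open import Function.Construct.Identity using (⇔-id)
open import Relation.Binary.Bundles using (Poset)

-- dh and hd copy may/□ and must/◇ verbatim, so the two refinement
-- conditions are the same type on both sides.
module _ (P : Poset 0ℓ 0ℓ 0ℓ) where

  ≤mD⇔≤mN-dh : (D₁ D₂ : DMTS P) →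
    _≤mD_ P (pre D₁) (pre D₂) ⇔ _≤mN_ P (dh P D₁) (dh P D₂)
  ≤mD⇔≤mN-dh D₁ D₂ = ⇔-id _

  ≤mN⇔≤mD-hd : (E₁ E₂ : NF P) →
    _≤mN_ P E₁ E₂ ⇔ _≤mD_ P (hd P E₁) (hd P E₂)
  ≤mN⇔≤mD-hd E₁ E₂ = ⇔-id _

theorem3 : (P : Poset 0ℓ 0ℓ 0ℓ) →
    (∀ (D₁ D₂ : DMTS P) →
       (_≤mD_ P (pre D₁) (pre D₂)) ⇔ (_≤mN_ P (dh P D₁) (dh P D₂)))
    × (∀ (E₁ E₂ : NF P) →
       (_≤mN_ P E₁ E₂) ⇔ (_≤mD_ P (hd P E₁) (hd P E₂)))
theorem3 P = ≤mD⇔≤mN-dh P , ≤mN⇔≤mD-hd P
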